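{- Let $(P,\mathcal{L})$ be a partial linear space, and let $\mathcal{C}\subseteq\mathcal{L}$ be a set of mutually intersecting lines. (1) If $(P,\mathcal{L})$ contains no triangle, then $\mathcal{C}$ is contained in a pencil (the set of all lines through some point); thus the maximal cliques in the confluence graph of $(P,\mathcal{L})$ are the pencils. This applies to all generalized $m$-gons with $m>3$ and to all near $m$-gons with $m>3$. (2) If $(P,\mathcal{L})$ contains a triangle but no O'Nan configuration, then $\mathcal{C}$ is contained in a pencil, or in a near pencil comprising at least $3$ lines.
   Context: A partial linear space is an incidence geometry $(P,\mathcal{L},I)$ in which any two distinct points are incident with at most one common line, and each line is incident with at least two points. Its confluence graph has vertex set $\mathcal{L}$, two distinct lines being adjacent if they share a point. A triangle consists of three points, pairwise collinear, not all on one line (equivalently, three lines pairwise meeting in three distinct points). An O'Nan configuration consists of $6$ points and $4$ mutually intersecting lines such that each of the lines is incident with exactly $3$ of the points and each of the points is incident with exactly $2$ of the lines. For a non-incident pair $(p,L)$, the near pencil determined by $(p,L)$ consists of $L$ together with all lines joining $p$ to points on $L$. A generalized $m$-gon is an incidence geometry whose bipartite incidence graph has diameter $m$ and girth $2m$. A near polygon is a partial linear space such that for every point $p$ and line $L$ there is a unique point on $L$ nearest to $p$ in the collinearity graph; a near $2d$-gon is a near polygon whose collinearity graph has diameter $d$. -}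

module Defs where

open import Data.Fin using (Fin)
open import Data.Product using (Σ; ∃; ∃-syntax; _×_; _,_)
open import Data.Sum using (_⊎_)
open import Relation.Nullary using (¬_)
open import Relation.Binary.PropositionalEquality using (_≡_; _≢_)

record PartialLinearSpace : Set₁ where
  field
    Point : Set
    Line  : Set
    _I_   : Point → Line → Set
    atMostOneLine : ∀ {p q M N} → p ≢ q → p I M → q I M → p I N → q I N → M ≡ N
    twoPoints     : ∀ M → ∃[ p ] ∃[ q ] (p ≢ q × p I M × q I M)

module _ (S : PartialLinearSpace) where
  open PartialLinearSpace S

  -- two lines share a point (adjacency in the confluence graph, for distinct lines)
  Meet : Line → Line → Set
  Meet M N = ∃[ p ] (p I M × p I N)

  MutuallyIntersecting : (Line → Set) → Set
  MutuallyIntersecting C = ∀ M N → C M → C N → M ≢ N → Meet M N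

  Collinear : Point → Point → Set
  Collinear p q = ∃[ M ] (p I M × q I M)

  HasTriangle : Set
  HasTriangle = ∃[ a ] ∃[ b ] ∃[ c ]
    (a ≢ b × a ≢ c × b ≢ c ×
     Collinear a b × Collinear a c × Collinear b c ×
     ¬ (∃[ M ] (a I M × b I M × c I M)))

  ExactlyThree : ∀ {n} → (Fin n → Set) → Set
  ExactlyThree {n} Q = ∃[ i ] ∃[ j ] ∃[ k ]
    (i ≢ j × i ≢ k × j ≢ k × Q i × Q j × Q k ×
     (∀ x → Q x → (x ≡ i ⊎ x ≡ j ⊎ x ≡ k)))

  ExactlyTwo : ∀ {n} → (Fin n → Set) → Set
  ExactlyTwo {n} Q = ∃[ i ] ∃[ j ]
    (i ≢ j × Q i × Q j × (∀ x → Q x → (x ≡ i ⊎ x ≡ j)))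

  HasONan : Set
  HasONan = Σ (Fin 6 → Point) λ pt → Σ (Fin 4 → Line) λ ln →
    (∀ a b → pt a ≡ pt b → a ≡ b) ×
    (∀ i j → ln i ≡ ln j → i ≡ j) ×
    (∀ i j → Meet (ln i) (ln j)) ×
    (∀ i → ExactlyThree (λ a → pt a I ln i)) ×
    (∀ a → ExactlyTwo (λ i → pt a I ln i))

  Pencil : Point → Line → Set
  Pencil p M = p I M

  NearPencil : Point → Line → Line → Set
  NearPencil p L M = M ≡ L ⊎ (p I M × ∃[ q ] (q I L × q I M))

  _⊆ᴸ_ : (Line → Set) → (Line → Set) → Set
  C ⊆ᴸ D = ∀ M → C M → D M

  ContainedInPencil : (Line → Set) → Set
  ContainedInPencil C = ∃[ p ] (C ⊆ᴸ Pencil p)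

  ContainedInNearPencil≥3 : (Line → Set) → Set
  ContainedInNearPencil≥3 C = ∃[ p ] ∃[ L ]
    (¬ (p I L) ×
     (∃[ M₁ ] ∃[ M₂ ] ∃[ M₃ ]
        (M₁ ≢ M₂ × M₁ ≢ M₃ × M₂ ≢ M₃ ×
         NearPencil p L M₁ × NearPencil p L M₂ × NearPencil p L M₃)) ×
     C ⊆ᴸ NearPencil p L)

-- Suppose C lies in no pencil. Then C contains three lines M, N, K without a common point, and
-- their pairwise intersections a = M ∩ N, b = M ∩ K, c = N ∩ K form a triangle; this gives (1).
-- Four lines of C no three of which are concurrent form a complete quadrilateral, i.e. an O'Nan
-- configuration. So if there is none, every line of C passes through a, b or c, and at most one
-- vertex lies on a line of C other than the two sides through it: two such lines, together with
-- the two sides not through both vertices, would form an O'Nan configuration. If neither b nor c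
-- does, then C lies in the near pencil of (a, K), which contains M, N and K.
module Submission where

open import Defs
open import Data.Product using (_×_)
open import Data.Sum using (_⊎_)
open import Relation.Nullary using (¬_)
open import Axiom.ExcludedMiddle using (ExcludedMiddle)
open import Level using (0ℓ)
open PartialLinearSpace using (Point; Line)

open import Data.Empty using (⊥-elim)
open import Data.Fin using (Fin; zero; suc; #_; _≟_)
open import Data.Fin.Properties using (any?; all?)
open import Data.Product using (∃-syntax; _,_; proj₁; proj₂)
open import Data.Sum using (inj₁; inj₂; [_,_]′)
open import Function using (_∘_)
open import Relation.Nullary using (Dec; yes; no; ¬?)
open import Relation.Nullary.Decidable using (_×-dec_; _⊎-dec_; _→-dec_; from-yes; decidable-stable)
open import Relation.Unary using (Decidable)
open import Relation.Binary.PropositionalEquality using (_≡_; _≢_; refl; sym; subst)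

module CompleteQuadrilateral (S : PartialLinearSpace) where
  open PartialLinearSpace S using (_I_)

  -- Vertex v : Fin 6 is the intersection of the sides side₁ v and side₂ v (of the four sides
  -- Fin 4); the incidence facts below are checked by evaluating decision procedures.
  side₁ side₂ : Fin 6 → Fin 4
  side₁ zero                            = # 0
  side₁ (suc zero)                      = # 0
  side₁ (suc (suc zero))                = # 0
  side₁ (suc (suc (suc zero)))          = # 1
  side₁ (suc (suc (suc (suc zero))))    = # 1
  side₁ (suc (suc (suc (suc (suc _))))) = # 2
  side₂ zero                            = # 1
  side₂ (suc zero)                      = # 2
  side₂ (suc (suc zero))                = # 3
  side₂ (suc (suc (suc zero)))          = # 2
  side₂ (suc (suc (suc (suc zero))))    = # 3
  side₂ (suc (suc (suc (suc (suc _))))) = # 3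

  _on_ : Fin 6 → Fin 4 → Set
  v on i = side₁ v ≡ i ⊎ side₂ v ≡ i

  _on?_ : ∀ v i → Dec (v on i)
  v on? i = side₁ v ≟ i ⊎-dec side₂ v ≟ i

  exactlyThree? : ∀ {n} {Q : Fin n → Set} → Decidable Q → Dec (ExactlyThree S Q)
  exactlyThree? Q? = any? λ i → any? λ j → any? λ k →
    ¬? (i ≟ j) ×-dec ¬? (i ≟ k) ×-dec ¬? (j ≟ k) ×-dec Q? i ×-dec Q? j ×-dec Q? k ×-dec
    all? λ x → Q? x →-dec (x ≟ i ⊎-dec x ≟ j ⊎-dec x ≟ k)

  exactlyTwo? : ∀ {n} {Q : Fin n → Set} → Decidable Q → Dec (ExactlyTwo S Q)
  exactlyTwo? Q? = any? λ i → any? λ j →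
    ¬? (i ≟ j) ×-dec Q? i ×-dec Q? j ×-dec all? λ x → Q? x →-dec (x ≟ i ⊎-dec x ≟ j)

  exactlyThree-cong : ∀ {n} {P Q : Fin n → Set} →
    (∀ x → P x → Q x) → (∀ x → Q x → P x) → ExactlyThree S P → ExactlyThree S Q
  exactlyThree-cong to from (i , j , k , i≢j , i≢k , j≢k , Pi , Pj , Pk , only) =
    i , j , k , i≢j , i≢k , j≢k , to i Pi , to j Pj , to k Pk , λ x Qx → only x (from x Qx)

  exactlyTwo-cong : ∀ {n} {P Q : Fin n → Set} →
    (∀ x → P x → Q x) → (∀ x → Q x → P x) → ExactlyTwo S P → ExactlyTwo S Q
  exactlyTwo-cong to from (i , j , i≢j , Pi , Pj , only) =
    i , j , i≢j , to i Pi , to j Pj , λ x Qx → only x (from x Qx)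

  side-has-three-vertices : ∀ i → ExactlyThree S (_on i)
  side-has-three-vertices = from-yes (all? λ i → exactlyThree? (_on? i))

  vertex-on-two-sides : ∀ v → ExactlyTwo S (v on_)
  vertex-on-two-sides = from-yes (all? λ v → exactlyTwo? (v on?_))

  sides-meet-at-vertex : ∀ i j → ∃[ v ] (v on i × v on j)
  sides-meet-at-vertex = from-yes (all? λ i → all? λ j → any? λ v → v on? i ×-dec v on? j)

  vertices-separated : ∀ v w → v ≢ w → ∃[ i ] (v on i × ¬ w on i)
  vertices-separated = from-yes (all? λ v → all? λ w →
    ¬? (v ≟ w) →-dec any? λ i → v on? i ×-dec ¬? (w on? i))

  sides-separated : ∀ i j → i ≢ j → ∃[ v ] (v on i × ¬ v on j)
  sides-separated = from-yes (all? λ i → all? λ j →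
    ¬? (i ≟ j) →-dec any? λ v → v on? i ×-dec ¬? (v on? j))

  off-side⇒all-sides-but-one : ∀ v i → ¬ v on i → ∃[ l ] (∀ k → k ≢ l → v on k ⊎ k ≡ i)
  off-side⇒all-sides-but-one = from-yes (all? λ v → all? λ i →
    ¬? (v on? i) →-dec any? λ l → all? λ k → ¬? (k ≟ l) →-dec (v on? k ⊎-dec k ≟ i))

  completeQuadrilateral⇒ONan : (ln : Fin 4 → Line S) (pt : Fin 6 → Point S) →
    (∀ v i → v on i → pt v I ln i) →
    (∀ l z → ¬ (∀ i → i ≢ l → z I ln i)) →
    HasONan S
  completeQuadrilateral⇒ONan ln pt on⇒I noThreeConcurrent =
    pt , ln , pt-injective , ln-injective , sides-meet ,
    (λ i → exactlyThree-cong (λ v → on⇒I v i) (λ v → I⇒on v i) (side-has-three-vertices i)) ,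
    (λ v → exactlyTwo-cong (on⇒I v) (I⇒on v) (vertex-on-two-sides v))
    where
      off⇒¬I : ∀ v i → ¬ v on i → ¬ pt v I ln i
      off⇒¬I v i v-off-i vi with off-side⇒all-sides-but-one v i v-off-i
      ... | l , cover = noThreeConcurrent l (pt v) λ k k≢l →
        [ on⇒I v k , (λ k≡i → subst (λ j → pt v I ln j) (sym k≡i) vi) ]′ (cover k k≢l)

      I⇒on : ∀ v i → pt v I ln i → v on i
      I⇒on v i vi = decidable-stable (v on? i) λ v-off-i → off⇒¬I v i v-off-i vi

      pt-injective : ∀ v w → pt v ≡ pt w → v ≡ w
      pt-injective v w pv≡pw = decidable-stable (v ≟ w) λ v≢w →
        let (i , vi , w-off-i) = vertices-separated v w v≢w
        in off⇒¬I w i w-off-i (subst (_I ln i) pv≡pw (on⇒I v i vi))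

      ln-injective : ∀ i j → ln i ≡ ln j → i ≡ j
      ln-injective i j li≡lj = decidable-stable (i ≟ j) λ i≢j →
        let (v , vi , v-off-j) = sides-separated i j i≢j
        in off⇒¬I v j v-off-j (subst (pt v I_) li≡lj (on⇒I v i vi))

      sides-meet : ∀ i j → Meet S (ln i) (ln j)
      sides-meet i j =
        let (v , vi , vj) = sides-meet-at-vertex i j in pt v , on⇒I v i vi , on⇒I v j vj

module _ (em : ExcludedMiddle 0ℓ) (S : PartialLinearSpace) where
  open PartialLinearSpace S using (_I_; atMostOneLine; twoPoints)
  open CompleteQuadrilateral S using (side₁; side₂; _on_; completeQuadrilateral⇒ONan)

  Concurrent : Line S → Line S → Line S → Set
  Concurrent L L′ L″ = ∃[ z ] (z I L × z I L′ × z I L″)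

  meetingPoint-unique : ∀ {L L′ p q} → L ≢ L′ → p I L → p I L′ → q I L → q I L′ → p ≡ q
  meetingPoint-unique L≢L′ pL pL′ qL qL′ =
    decidable-stable em λ p≢q → L≢L′ (atMostOneLine p≢q pL qL pL′ qL′)

  throughMeetingPoint : ∀ {L L′ L″ v z} →
    L ≢ L′ → v I L → v I L′ → z I L → z I L′ → z I L″ → v I L″
  throughMeetingPoint L≢L′ vL vL′ zL zL′ =
    subst (_I _) (meetingPoint-unique L≢L′ zL zL′ vL vL′)

  module MutuallyIntersectingLines (C : Line S → Set) (mi : MutuallyIntersecting S C) where

    meet : ∀ {L L′} → C L → C L′ → Meet S L L′
    meet {L} {L′} L∈C L′∈C with em {L ≡ L′}
    ... | yes refl = let (p , _ , _ , pL , _) = twoPoints L in p , pL , pL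
    ... | no L≢L′ = mi L L′ L∈C L′∈C L≢L′

    fourLines⇒ONan : ∀ {L₀ L₁ L₂ L₃} → C L₀ → C L₁ → C L₂ → C L₃ →
      ¬ Concurrent L₁ L₂ L₃ → ¬ Concurrent L₀ L₂ L₃ →
      ¬ Concurrent L₀ L₁ L₃ → ¬ Concurrent L₀ L₁ L₂ →
      HasONan S
    fourLines⇒ONan {L₀} {L₁} {L₂} {L₃} L₀∈C L₁∈C L₂∈C L₃∈C ¬123 ¬023 ¬013 ¬012 =
      completeQuadrilateral⇒ONan ln pt on⇒I noThreeConcurrent
      where
        ln : Fin 4 → Line S
        ln zero                   = L₀
        ln (suc zero)             = L₁
        ln (suc (suc zero))       = L₂
        ln (suc (suc (suc zero))) = L₃

        ln∈C : ∀ i → C (ln i)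
        ln∈C zero                   = L₀∈C
        ln∈C (suc zero)             = L₁∈C
        ln∈C (suc (suc zero))       = L₂∈C
        ln∈C (suc (suc (suc zero))) = L₃∈C

        vertex : ∀ v → Meet S (ln (side₁ v)) (ln (side₂ v))
        vertex v = meet (ln∈C (side₁ v)) (ln∈C (side₂ v))

        pt : Fin 6 → Point S
        pt v = proj₁ (vertex v)

        on⇒I : ∀ v i → v on i → pt v I ln i
        on⇒I v _ (inj₁ refl) = proj₁ (proj₂ (vertex v))
        on⇒I v _ (inj₂ refl) = proj₂ (proj₂ (vertex v))

        noThreeConcurrent : ∀ l z → ¬ (∀ i → i ≢ l → z I ln i)
        noThreeConcurrent zero                   z on = ¬123 (z , on (# 1) (λ ()) , on (# 2) (λ ()) , on (# 3) (λ ()))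
        noThreeConcurrent (suc zero)             z on = ¬023 (z , on (# 0) (λ ()) , on (# 2) (λ ()) , on (# 3) (λ ()))
        noThreeConcurrent (suc (suc zero))       z on = ¬013 (z , on (# 0) (λ ()) , on (# 1) (λ ()) , on (# 3) (λ ()))
        noThreeConcurrent (suc (suc (suc zero))) z on = ¬012 (z , on (# 0) (λ ()) , on (# 1) (λ ()) , on (# 2) (λ ()))

    avoidingLine : ¬ ContainedInPencil S C → ∀ p → ∃[ L ] (C L × ¬ p I L)
    avoidingLine ¬pencil p = decidable-stable em λ ∄ →
      ¬pencil (p , λ L L∈C → decidable-stable em λ ¬pL → ∄ (L , L∈C , ¬pL))

    AnotherLineThrough : Point S → Line S → Line S → Set
    AnotherLineThrough v P Q = ∃[ L ] (C L × v I L × L ≢ P × L ≢ Q)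

    OnlyLinesThrough : Point S → Line S → Line S → Set
    OnlyLinesThrough v P Q = ∀ L → C L → v I L → L ≡ P ⊎ L ≡ Q

    anotherLine⊎onlyLines : ∀ v P Q → AnotherLineThrough v P Q ⊎ OnlyLinesThrough v P Q
    anotherLine⊎onlyLines v P Q with em {AnotherLineThrough v P Q}
    ... | yes another = inj₁ another
    ... | no ∄ = inj₂ λ L L∈C vL → decidable-stable em λ ¬PQ →
      ∄ (L , L∈C , vL , ¬PQ ∘ inj₁ , ¬PQ ∘ inj₂)

    record Trilateral : Set where
      field
        M N K : Line S
        a b c : Point S
        M∈C : C M
        N∈C : C N
        K∈C : C K
        aM : a I M
        aN : a I N
        bM : b I M
        bK : b I K
        cN : c I N
        cK : c I K
        nonConcurrent : ¬ Concurrent M N K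

    -- The apex of T (the vertex a = M ∩ N opposite K) is c for rotate T and b for rotate (rotate T).
    rotate : Trilateral → Trilateral
    rotate T = record
      { M = N ; N = K ; K = M ; a = c ; b = a ; c = b
      ; M∈C = N∈C ; N∈C = K∈C ; K∈C = M∈C
      ; aM = cN ; aN = cK ; bM = aN ; bK = aM ; cN = bK ; cK = bM
      ; nonConcurrent = λ (z , zN , zK , zM) → nonConcurrent (z , zM , zN , zK)
      }
      where open Trilateral T

    trilateral : Point S → ¬ ContainedInPencil S C → Trilateral
    trilateral p ¬pencil with avoidingLine ¬pencil p
    ... | M , M∈C , _ with twoPoints M
    ... | x , _ , _ , xM , _ with avoidingLine ¬pencil x
    ... | N , N∈C , x∉N with meet M∈C N∈C
    ... | a , aM , aN with avoidingLine ¬pencil a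
    ... | K , K∈C , a∉K with meet M∈C K∈C | meet N∈C K∈C
    ... | b , bM , bK | c , cN , cK = record
      { M = M ; N = N ; K = K ; a = a ; b = b ; c = c
      ; M∈C = M∈C ; N∈C = N∈C ; K∈C = K∈C
      ; aM = aM ; aN = aN ; bM = bM ; bK = bK ; cN = cN ; cK = cK
      ; nonConcurrent = λ (z , zM , zN , zK) → a∉K (throughMeetingPoint M≢N aM aN zM zN zK)
      }
      where
        M≢N : M ≢ N
        M≢N M≡N = x∉N (subst (x I_) M≡N xM)

    module _ (T : Trilateral) where
      open Trilateral T

      a∉K : ¬ a I K
      a∉K aK = nonConcurrent (a , aM , aN , aK)

      b∉N : ¬ b I N
      b∉N bN = nonConcurrent (b , bM , bN , bK)

      c∉M : ¬ c I M
      c∉M cM = nonConcurrent (c , cM , cN , cK)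

      M≢N : M ≢ N
      M≢N M≡N = b∉N (subst (b I_) M≡N bM)

      M≢K : M ≢ K
      M≢K M≡K = a∉K (subst (a I_) M≡K aM)

      N≢K : N ≢ K
      N≢K N≡K = a∉K (subst (a I_) N≡K aN)

      a≢b : a ≢ b
      a≢b a≡b = a∉K (subst (_I K) (sym a≡b) bK)

      a≢c : a ≢ c
      a≢c a≡c = a∉K (subst (_I K) (sym a≡c) cK)

      b≢c : b ≢ c
      b≢c b≡c = b∉N (subst (_I N) (sym b≡c) cN)

      hasTriangle : HasTriangle S
      hasTriangle = a , b , c , a≢b , a≢c , b≢c , (M , aM , bM) , (N , aN , cN) , (K , bK , cK) ,
        λ (L , aL , bL , cL) → c∉M (subst (c I_) (atMostOneLine a≢b aL bL aM bM) cL)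

      lineOffVertices⇒ONan : ∀ {L} → C L → ¬ a I L → ¬ b I L → ¬ c I L → HasONan S
      lineOffVertices⇒ONan L∈C a∉L b∉L c∉L = fourLines⇒ONan M∈C N∈C K∈C L∈C
        (λ (z , zN , zK , zL) → c∉L (throughMeetingPoint N≢K cN cK zN zK zL))
        (λ (z , zM , zK , zL) → b∉L (throughMeetingPoint M≢K bM bK zM zK zL))
        (λ (z , zM , zN , zL) → a∉L (throughMeetingPoint M≢N aM aN zM zN zL))
        nonConcurrent

      throughVertex : ¬ HasONan S → ∀ {L} → C L → a I L ⊎ b I L ⊎ c I L
      throughVertex ¬onan L∈C = decidable-stable em λ ¬abc →
        ¬onan (lineOffVertices⇒ONan L∈C (¬abc ∘ inj₁) (¬abc ∘ inj₂ ∘ inj₁) (¬abc ∘ inj₂ ∘ inj₂))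

      anotherLineAtApex⊎onlySides : AnotherLineThrough a M N ⊎ OnlyLinesThrough a M N
      anotherLineAtApex⊎onlySides = anotherLine⊎onlyLines a M N

      anotherLinesThrough-a-c⇒ONan : AnotherLineThrough a M N → AnotherLineThrough c N K → HasONan S
      anotherLinesThrough-a-c⇒ONan (X , X∈C , aX , X≢M , X≢N) (Y , Y∈C , cY , Y≢N , Y≢K) =
        fourLines⇒ONan X∈C Y∈C M∈C K∈C
          (λ (z , zY , zM , zK) → Y≢K (atMostOneLine b≢c (throughMeetingPoint M≢K bM bK zM zK zY) cY bK cK))
          (λ (z , zX , zM , zK) → X≢M (atMostOneLine a≢b aX (throughMeetingPoint M≢K bM bK zM zK zX) aM bM))
          (λ (z , zX , zY , zK) → X≢N (atMostOneLine a≢c aX (throughMeetingPoint Y≢K cY cK zY zK zX) aN cN))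
          (λ (z , zX , zY , zM) → Y≢N (atMostOneLine a≢c (throughMeetingPoint X≢M aX aM zX zM zY) cY aN cN))

      M∈nearPencil : NearPencil S a K M
      M∈nearPencil = inj₂ (aM , b , bK , bM)

      N∈nearPencil : NearPencil S a K N
      N∈nearPencil = inj₂ (aN , c , cK , cN)

      K∈nearPencil : NearPencil S a K K
      K∈nearPencil = inj₁ refl

      containedInNearPencilAtApex : ¬ HasONan S →
        OnlyLinesThrough c N K → OnlyLinesThrough b K M → ContainedInNearPencil≥3 S C
      containedInNearPencilAtApex ¬onan onlyC onlyB =
        a , K , a∉K ,
        (M , N , K , M≢N , M≢K , N≢K , M∈nearPencil , N∈nearPencil , K∈nearPencil) ,
        C⊆nearPencil
        where
          C⊆nearPencil : _⊆ᴸ_ S C (NearPencil S a K)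
          C⊆nearPencil L L∈C = [ throughA , [ throughB , throughC ]′ ]′ (throughVertex ¬onan L∈C)
            where
              throughA : a I L → NearPencil S a K L
              throughA aL = inj₂ (aL , meet K∈C L∈C)

              throughB : b I L → NearPencil S a K L
              throughB bL with onlyB L L∈C bL
              ... | inj₁ refl = K∈nearPencil
              ... | inj₂ refl = M∈nearPencil

              throughC : c I L → NearPencil S a K L
              throughC cL with onlyC L L∈C cL
              ... | inj₁ refl = N∈nearPencil
              ... | inj₂ refl = K∈nearPencil

    containedInNearPencil≥3 : Trilateral → ¬ HasONan S → ContainedInNearPencil≥3 S C
    containedInNearPencil≥3 T ¬onan
      with anotherLineAtApex⊎onlySides T
         | anotherLineAtApex⊎onlySides (rotate T)
         | anotherLineAtApex⊎onlySides (rotate (rotate T))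
    ... | inj₁ atA    | inj₁ atC    | _          = ⊥-elim (¬onan (anotherLinesThrough-a-c⇒ONan T atA atC))
    ... | _           | inj₁ atC    | inj₁ atB   = ⊥-elim (¬onan (anotherLinesThrough-a-c⇒ONan (rotate T) atC atB))
    ... | inj₁ atA    | _           | inj₁ atB   = ⊥-elim (¬onan (anotherLinesThrough-a-c⇒ONan (rotate (rotate T)) atB atA))
    ... | _           | inj₂ onlyC  | inj₂ onlyB = containedInNearPencilAtApex T ¬onan onlyC onlyB
    ... | inj₂ onlyA  | _           | inj₂ onlyB = containedInNearPencilAtApex (rotate T) ¬onan onlyB onlyA
    ... | inj₂ onlyA  | inj₂ onlyC  | _          = containedInNearPencilAtApex (rotate (rotate T)) ¬onan onlyA onlyC

proposition3p1 : ExcludedMiddle 0ℓ → (S : PartialLinearSpace) → Point S →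
    (C : Line S → Set) → MutuallyIntersecting S C →
    ((¬ HasTriangle S → ContainedInPencil S C) ×
     (HasTriangle S → ¬ HasONan S →
        (ContainedInPencil S C ⊎ ContainedInNearPencil≥3 S C)))
proposition3p1 em S p C mi with em {ContainedInPencil S C}
... | yes inPencil = (λ _ → inPencil) , (λ _ _ → inj₁ inPencil)
... | no ¬inPencil =
  (λ ¬triangle → ⊥-elim (¬triangle (hasTriangle T))) ,
  (λ _ ¬onan → inj₂ (containedInNearPencil≥3 T ¬onan))
  where
    open MutuallyIntersectingLines em S C mi
    T : Trilateral
    T = trilateral p ¬inPencil
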